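{- Let $n\ge1$. In unlabeled chip-firing on the infinite binary tree with a self-loop at the root, starting with $2^n-1$ chips at the root, in any firing sequence leading to the terminal configuration, for every $0\le i<n$ every node on level $n-i$ fires exactly $\genfrac{\langle}{\rangle}{0pt}{}{i+1}{1}=2^{i+1}-(i+2)$ times.
   Context: The infinite binary tree has nodes labeled by positive integers: node $1$ is the root, node $i$ has children $2i$ and $2i+1$ and (for $i>1$) parent $\lfloor i/2\rfloor$. A self-loop is added at the root, so every node has degree $3$. The level of node $i$ is $\lfloor\log_2 i\rfloor+1$. Unlabeled chip-firing: a node with at least $3$ (indistinguishable) chips may fire, sending one chip to each of its two children and one to its parent (the root sends this chip to itself). A configuration is terminal if no node has $3$ or more chips. $\genfrac{\langle}{\rangle}{0pt}{}{m}{k}$ denotes the Eulerian number, the number of permutations of $\{1,\dots,m\}$ with exactly $k$ descents; in particular $\genfrac{\langle}{\rangle}{0pt}{}{m}{1}=2^m-(m+1)$. -}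

module Defs where

open import Data.Nat using (ℕ; zero; suc; _+_; _*_; _∸_; _^_; _≤_; _<_; _≡ᵇ_; ⌊_/2⌋)
open import Data.Nat.Logarithm using (⌊log₂_⌋)
open import Data.Bool using (if_then_else_)
open import Data.List using (List; []; _∷_)

-- A chip configuration: number of chips at each node label (label 0 is unused).
Config : Set
Config = ℕ → ℕ

δ : ℕ → ℕ → ℕ
δ a b = if a ≡ᵇ b then 1 else 0

-- parent of node v (v ≥ 1); the root's parent is itself (self-loop)
parent : ℕ → ℕ
parent v = if v ≡ᵇ 1 then 1 else ⌊ v /2⌋

level : ℕ → ℕ
level i = ⌊log₂ i ⌋ + 1

fire : ℕ → Config → Config
fire v c w = (if w ≡ᵇ v then c w ∸ 3 else c w)
           + δ w (2 * v) + δ w (2 * v + 1) + δ w (parent v)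

data Run : Config → List ℕ → Config → Set where
  done : ∀ {c} → Run c [] c
  step : ∀ {c c' v vs} → 1 ≤ v → 3 ≤ c v → Run (fire v c) vs c' → Run c (v ∷ vs) c'

Terminal : Config → Set
Terminal c = ∀ w → c w < 3

initial : ℕ → Config
initial n w = if w ≡ᵇ 1 then 2 ^ n ∸ 1 else 0

eulerian1 : ℕ → ℕ
eulerian1 m = 2 ^ m ∸ (m + 1)

timesFired : ℕ → List ℕ → ℕ
timesFired v [] = 0
timesFired v (w ∷ ws) = δ w v + timesFired v ws

-- Put u(w) = ⟨i+1,1⟩ for w on level n − i (so u vanishes from level n on).
-- Firing every node w exactly u(w) times from 2^n − 1 chips at the root
-- leaves one chip on each node of levels 1..n, a stable configuration, so by
-- the least action principle no legal firing sequence fires a node w more than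
-- u(w) times.  For a sequence ending in a terminal configuration the deficit
-- e = u − (firing counts) satisfies 3 e(w) ≤ 1 + (sum of e over the three
-- neighbours of w) and vanishes from level n on.  Working up from level n,
-- such an e is strictly smaller at a node than at its parent wherever it is
-- positive; the root is its own parent, so e vanishes at the root and then,
-- going down, everywhere.
module Submission where

open import Defs
open import Data.Nat using (ℕ; _+_; _∸_; _≤_; _<_)
open import Data.List using (List)
open import Relation.Binary.PropositionalEquality using (_≡_)

open import Data.Bool using (true; false; if_then_else_; T)
open import Data.Empty using (⊥; ⊥-elim)
open import Data.Unit using (tt)
open import Data.List using (_∷_)
open import Data.Nat using (zero; suc; _*_; _^_; _≡ᵇ_; ⌊_/2⌋; z≤n; s≤s)
open import Data.Nat.Induction using (<-rec)
open import Data.Nat.Logarithm using (⌊log₂_⌋; ⌊log₂⌊n/2⌋⌋≡⌊log₂n⌋∸1; ⌊log₂⌋-mono-≤)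
open import Data.Nat.Properties
open import Data.Nat.Tactic.RingSolver using (solve-∀)
open import Relation.Binary.PropositionalEquality
  using (refl; sym; trans; cong; cong₂; subst; module ≡-Reasoning)
open import Relation.Nullary using (yes; no)

parent-≥2 : ∀ w → 2 ≤ w → parent w ≡ ⌊ w /2⌋
parent-≥2 (suc (suc w)) (s≤s (s≤s z≤n)) = refl

⌊2*n/2⌋≡n : ∀ n → ⌊ 2 * n /2⌋ ≡ n
⌊2*n/2⌋≡n n rewrite +-identityʳ n = sym (n≡⌊n+n/2⌋ n)

⌊2*n+1/2⌋≡n : ∀ n → ⌊ 2 * n + 1 /2⌋ ≡ n
⌊2*n+1/2⌋≡n n rewrite +-identityʳ n | +-comm (n + n) 1 = sym (n≡⌈n+n/2⌉ n)

2≤2*n : ∀ {n} → 1 ≤ n → 2 ≤ 2 * n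
2≤2*n = *-monoʳ-≤ 2

2≤2*n+1 : ∀ {n} → 1 ≤ n → 2 ≤ 2 * n + 1
2≤2*n+1 {n} 1≤n = ≤-trans (2≤2*n 1≤n) (m≤m+n (2 * n) 1)

parent-2* : ∀ y → 1 ≤ y → parent (2 * y) ≡ y
parent-2* y 1≤y = trans (parent-≥2 _ (2≤2*n 1≤y)) (⌊2*n/2⌋≡n y)

parent-2*+1 : ∀ y → 1 ≤ y → parent (2 * y + 1) ≡ y
parent-2*+1 y 1≤y = trans (parent-≥2 _ (2≤2*n+1 1≤y)) (⌊2*n+1/2⌋≡n y)

level-parent : ∀ w → 2 ≤ w → level w ≡ suc (level (parent w))
level-parent w 2≤w = begin
  ⌊log₂ w ⌋ + 1            ≡⟨ +-comm ⌊log₂ w ⌋ 1 ⟩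
  suc ⌊log₂ w ⌋            ≡⟨ cong suc (sym (m∸n+n≡m 1≤log)) ⟩
  suc (⌊log₂ w ⌋ ∸ 1 + 1)  ≡⟨ cong (λ k → suc (k + 1)) (sym (⌊log₂⌊n/2⌋⌋≡⌊log₂n⌋∸1 w)) ⟩
  suc (level ⌊ w /2⌋)      ≡⟨ cong (λ u → suc (level u)) (sym (parent-≥2 w 2≤w)) ⟩
  suc (level (parent w))   ∎
  where
  open ≡-Reasoning
  1≤log : 1 ≤ ⌊log₂ w ⌋
  1≤log = ⌊log₂⌋-mono-≤ 2≤w

level-2* : ∀ y → 1 ≤ y → level (2 * y) ≡ suc (level y)
level-2* y 1≤y = trans (level-parent _ (2≤2*n 1≤y)) (cong (λ u → suc (level u)) (parent-2* y 1≤y))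

level-2*+1 : ∀ y → 1 ≤ y → level (2 * y + 1) ≡ suc (level y)
level-2*+1 y 1≤y = trans (level-parent _ (2≤2*n+1 1≤y)) (cong (λ u → suc (level u)) (parent-2*+1 y 1≤y))

δ-sym : ∀ a b → δ a b ≡ δ b a
δ-sym zero    zero    = refl
δ-sym zero    (suc b) = refl
δ-sym (suc a) zero    = refl
δ-sym (suc a) (suc b) = δ-sym a b

δ-children : ∀ w v → δ w (2 * v) + δ w (2 * v + 1) ≡ δ ⌊ w /2⌋ v
δ-children zero          zero    = refl
δ-children (suc zero)    zero    = refl
δ-children (suc (suc w)) zero    = refl
δ-children w             (suc v) =
  trans (cong (λ m → δ w m + δ w (m + 1)) (*-suc 2 v)) (shifted w)
  where
  shifted : ∀ w → δ w (2 + 2 * v) + δ w (2 + 2 * v + 1) ≡ δ ⌊ w /2⌋ (suc v)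
  shifted zero          = refl
  shifted (suc zero)    = refl
  shifted (suc (suc w)) = δ-children w v

-- The root's self-loop is the extra term δ v 1 * δ w 1.
δ-parent : ∀ v w → 1 ≤ w → δ w (parent v) ≡ δ w ⌊ v /2⌋ + δ v 1 * δ w 1
δ-parent zero          (suc w) _ = refl
δ-parent (suc zero)    (suc w) _ = sym (+-identityʳ (δ w 0))
δ-parent (suc (suc v)) (suc w) _ = sym (+-identityʳ _)

inflow : (ℕ → ℕ) → ℕ → ℕ
inflow x w = x (parent w) + x (2 * w) + x (2 * w + 1)

inflow-split : ∀ x y {z} → (∀ u → z u ≡ x u + y u) → ∀ w → inflow z w ≡ inflow x w + inflow y w
inflow-split x y z≡x+y w
  rewrite z≡x+y (parent w) | z≡x+y (2 * w) | z≡x+y (2 * w + 1) =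
  rearrange (x (parent w)) (y (parent w)) (x (2 * w)) (y (2 * w)) (x (2 * w + 1)) (y (2 * w + 1))
  where
  rearrange : ∀ a b c d e f → a + b + (c + d) + (e + f) ≡ a + c + e + (b + d + f)
  rearrange = solve-∀

neighbour-sym : ∀ v w → 1 ≤ v → 1 ≤ w →
  δ w (2 * v) + δ w (2 * v + 1) + δ w (parent v) ≡ inflow (δ v) w
neighbour-sym v w 1≤v 1≤w = begin
  δ w (2 * v) + δ w (2 * v + 1) + δ w (parent v)
    ≡⟨ cong₂ _+_ (δ-children w v) (δ-parent v w 1≤w) ⟩
  δ ⌊ w /2⌋ v + (δ w ⌊ v /2⌋ + δ v 1 * δ w 1)
    ≡⟨ cong₂ (λ a b → a + (b + δ v 1 * δ w 1))
             (δ-sym ⌊ w /2⌋ v) (trans (δ-sym w ⌊ v /2⌋) (sym (δ-children v w))) ⟩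
  δ v ⌊ w /2⌋ + (δ v (2 * w) + δ v (2 * w + 1) + δ v 1 * δ w 1)
    ≡⟨ rearrange (δ v ⌊ w /2⌋) (δ v (2 * w)) (δ v (2 * w + 1)) (δ v 1) (δ w 1) ⟩
  δ v ⌊ w /2⌋ + δ w 1 * δ v 1 + δ v (2 * w) + δ v (2 * w + 1)
    ≡⟨ cong (λ a → a + δ v (2 * w) + δ v (2 * w + 1)) (sym (δ-parent w v 1≤v)) ⟩
  inflow (δ v) w ∎
  where
  open ≡-Reasoning
  rearrange : ∀ a b c d e → a + (b + c + d * e) ≡ a + e * d + b + c
  rearrange = solve-∀

drain : ∀ v (c : Config) w → 3 ≤ c v →
  (if w ≡ᵇ v then c w ∸ 3 else c w) + 3 * (if w ≡ᵇ v then 1 else 0) ≡ c w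
drain v c w 3≤cv with w ≡ᵇ v in w≡ᵇv
... | true  = m∸n+n≡m (subst (λ u → 3 ≤ c u) (sym w≡v) 3≤cv)
  where
  w≡v : w ≡ v
  w≡v = ≡ᵇ⇒≡ w v (subst T (sym w≡ᵇv) tt)
... | false = +-identityʳ (c w)

fire-balance : ∀ v (c : Config) w → 1 ≤ v → 1 ≤ w → 3 ≤ c v →
  fire v c w + 3 * δ v w ≡ c w + inflow (δ v) w
fire-balance v c w 1≤v 1≤w 3≤cv = begin
  d + a + b + p + 3 * δ v w   ≡⟨ cong (λ t → d + a + b + p + 3 * t) (δ-sym v w) ⟩
  d + a + b + p + 3 * δ w v   ≡⟨ rearrange d a b p (δ w v) ⟩
  d + 3 * δ w v + (a + b + p) ≡⟨ cong₂ _+_ (drain v c w 3≤cv) (neighbour-sym v w 1≤v 1≤w) ⟩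
  c w + inflow (δ v) w        ∎
  where
  open ≡-Reasoning
  d a b p : ℕ
  d = if w ≡ᵇ v then c w ∸ 3 else c w
  a = δ w (2 * v)
  b = δ w (2 * v + 1)
  p = δ w (parent v)
  rearrange : ∀ d a b p t → d + a + b + p + 3 * t ≡ d + 3 * t + (a + b + p)
  rearrange = solve-∀

firings : List ℕ → ℕ → ℕ
firings vs u = timesFired u vs

run-balance : ∀ {c vs c′} → Run c vs c′ → ∀ w → 1 ≤ w →
  c′ w + 3 * timesFired w vs ≡ c w + inflow (firings vs) w
run-balance done w 1≤w = refl
run-balance {c} {v ∷ vs} {c′} (step 1≤v 3≤cv run) w 1≤w = begin
  c′ w + 3 * (δ v w + timesFired w vs)
    ≡⟨ rearrange₁ (c′ w) (δ v w) (timesFired w vs) ⟩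
  c′ w + 3 * timesFired w vs + 3 * δ v w
    ≡⟨ cong (_+ 3 * δ v w) (run-balance run w 1≤w) ⟩
  fire v c w + inflow (firings vs) w + 3 * δ v w
    ≡⟨ rearrange₂ (fire v c w) (inflow (firings vs) w) (3 * δ v w) ⟩
  fire v c w + 3 * δ v w + inflow (firings vs) w
    ≡⟨ cong (_+ inflow (firings vs) w) (fire-balance v c w 1≤v 1≤w 3≤cv) ⟩
  c w + inflow (δ v) w + inflow (firings vs) w
    ≡⟨ +-assoc (c w) _ _ ⟩
  c w + (inflow (δ v) w + inflow (firings vs) w)
    ≡⟨ cong (c w +_) (sym (inflow-split (δ v) (firings vs) (λ _ → refl) w)) ⟩
  c w + inflow (firings (v ∷ vs)) w ∎
  where
  open ≡-Reasoning
  rearrange₁ : ∀ a b d → a + 3 * (b + d) ≡ a + 3 * d + 3 * b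
  rearrange₁ = solve-∀
  rearrange₂ : ∀ a b d → a + b + d ≡ a + d + b
  rearrange₂ = solve-∀

-- Least action principle

-- Firing each node w exactly x w times from c would end in a stable configuration.
Stabilizes : Config → (ℕ → ℕ) → Set
Stabilizes c x = ∀ w → 1 ≤ w → c w + inflow x w ≤ 3 * x w + 2

stabilizes-fires : ∀ {c x v} → 1 ≤ v → 3 ≤ c v → Stabilizes c x → 1 ≤ x v
stabilizes-fires {c} {x} {v} 1≤v 3≤cv stab = positive (x v) 3≤3xv+2
  where
  3≤3xv+2 : 3 ≤ 3 * x v + 2
  3≤3xv+2 = ≤-trans 3≤cv (≤-trans (m≤m+n (c v) (inflow x v)) (stab v 1≤v))
  positive : ∀ a → 3 ≤ 3 * a + 2 → 1 ≤ a
  positive zero    (s≤s (s≤s ()))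
  positive (suc a) _ = s≤s z≤n

δ≤ : ∀ (x : ℕ → ℕ) v u → 1 ≤ x v → δ v u ≤ x u
δ≤ x v u 1≤xv with v ≡ᵇ u in v≡ᵇu
... | true  = subst (λ t → 1 ≤ x t) (≡ᵇ⇒≡ v u (subst T (sym v≡ᵇu) tt)) 1≤xv
... | false = z≤n

fire-stabilizes : ∀ {c x x′ v} → 1 ≤ v → 3 ≤ c v → Stabilizes c x →
  (∀ u → x u ≡ x′ u + δ v u) → Stabilizes (fire v c) x′
fire-stabilizes {c} {x} {x′} {v} 1≤v 3≤cv stab x≡x′+δ w 1≤w =
  +-cancelʳ-≤ (3 * δ v w) (fire v c w + inflow x′ w) (3 * x′ w + 2) (begin
    fire v c w + inflow x′ w + 3 * δ v w
      ≡⟨ rearrange₁ (fire v c w) (inflow x′ w) (3 * δ v w) ⟩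
    fire v c w + 3 * δ v w + inflow x′ w
      ≡⟨ cong (_+ inflow x′ w) (fire-balance v c w 1≤v 1≤w 3≤cv) ⟩
    c w + inflow (δ v) w + inflow x′ w
      ≡⟨ rearrange₂ (c w) (inflow (δ v) w) (inflow x′ w) ⟩
    c w + (inflow x′ w + inflow (δ v) w)
      ≡⟨ cong (c w +_) (sym (inflow-split x′ (δ v) x≡x′+δ w)) ⟩
    c w + inflow x w
      ≤⟨ stab w 1≤w ⟩
    3 * x w + 2
      ≡⟨ cong (λ t → 3 * t + 2) (x≡x′+δ w) ⟩
    3 * (x′ w + δ v w) + 2
      ≡⟨ rearrange₃ (x′ w) (δ v w) ⟩
    3 * x′ w + 2 + 3 * δ v w ∎)
  where
  open ≤-Reasoning
  rearrange₁ : ∀ a b d → a + b + d ≡ a + d + b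
  rearrange₁ = solve-∀
  rearrange₂ : ∀ a b d → a + b + d ≡ a + (d + b)
  rearrange₂ = solve-∀
  rearrange₃ : ∀ a b → 3 * (a + b) + 2 ≡ 3 * a + 2 + 3 * b
  rearrange₃ = solve-∀

least-action : ∀ {c vs c′} → Run c vs c′ → ∀ x → Stabilizes c x →
  ∀ u → timesFired u vs ≤ x u
least-action done x stab u = z≤n
least-action {c} (step {v = v} {vs = vs} 1≤v 3≤cv run) x stab u = begin
  δ v u + timesFired u vs  ≤⟨ +-monoʳ-≤ (δ v u) (least-action run x′ stab′ u) ⟩
  δ v u + x′ u             ≡⟨ +-comm (δ v u) (x′ u) ⟩
  x′ u + δ v u             ≡⟨ sym (x≡x′+δ u) ⟩
  x u                      ∎
  where
  open ≤-Reasoning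
  x′ : ℕ → ℕ
  x′ u = x u ∸ δ v u
  x≡x′+δ : ∀ u → x u ≡ x′ u + δ v u
  x≡x′+δ u = sym (m∸n+n≡m (δ≤ x v u (stabilizes-fires {c} {x} 1≤v 3≤cv stab)))
  stab′ : Stabilizes (fire v c) x′
  stab′ = fire-stabilizes 1≤v 3≤cv stab x≡x′+δ

-- Vanishing of the deficit

excess-to-parent : ∀ a p b c → 3 * a ≤ 1 + (p + b + c) → b < a → c < a → a < p
excess-to-parent a p b c 3a≤1+p+b+c b<a c<a = +-cancelʳ-≤ (2 * a) (suc a) p (begin
  suc a + 2 * a        ≡⟨ rearrange₁ a ⟩
  3 * a + 1            ≤⟨ +-monoˡ-≤ 1 3a≤1+p+b+c ⟩
  1 + (p + b + c) + 1  ≡⟨ rearrange₂ p b c ⟩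
  p + (suc b + suc c)  ≤⟨ +-monoʳ-≤ p (+-mono-≤ b<a c<a) ⟩
  p + (a + a)          ≡⟨ rearrange₃ p a ⟩
  p + 2 * a            ∎)
  where
  open ≤-Reasoning
  rearrange₁ : ∀ a → suc a + 2 * a ≡ 3 * a + 1
  rearrange₁ = solve-∀
  rearrange₂ : ∀ p b c → 1 + (p + b + c) + 1 ≡ p + (suc b + suc c)
  rearrange₂ = solve-∀
  rearrange₃ : ∀ p a → p + (a + a) ≡ p + 2 * a
  rearrange₃ = solve-∀

module Deficit (n : ℕ) (e : ℕ → ℕ)
  (vanishes-deep : ∀ w → n ≤ level w → e w ≡ 0)
  (subharmonic : ∀ w → 1 ≤ w → level w < n → 3 * e w ≤ 1 + inflow e w) where

  -- Induction on k ≥ n ∸ level y, i.e. upwards from level n, where e vanishes.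
  below-parent : ∀ k y → n ≤ k + level y → 1 ≤ y → 0 < e y → e y < e (parent y)
  below-parent zero    y n≤ly     _   0<ey = ⊥-elim (<-irrefl (sym (vanishes-deep y n≤ly)) 0<ey)
  below-parent (suc k) y n≤1+k+ly 1≤y 0<ey =
    excess-to-parent (e y) (e (parent y)) (e (2 * y)) (e (2 * y + 1))
      (subharmonic y 1≤y ly<n)
      (child-below (2 * y) (≤-trans (s≤s z≤n) (2≤2*n 1≤y)) (parent-2* y 1≤y) (level-2* y 1≤y))
      (child-below (2 * y + 1) (≤-trans (s≤s z≤n) (2≤2*n+1 1≤y)) (parent-2*+1 y 1≤y) (level-2*+1 y 1≤y))
    where
    ly<n : level y < n
    ly<n with n ≤? level y
    ... | yes n≤ly = ⊥-elim (<-irrefl (sym (vanishes-deep y n≤ly)) 0<ey)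
    ... | no  n≰ly = ≰⇒> n≰ly
    child-below : ∀ z → 1 ≤ z → parent z ≡ y → level z ≡ suc (level y) → e z < e y
    child-below z 1≤z pz≡y lz≡1+ly with e z ≟ 0
    ... | yes ez≡0 = subst (_< e y) (sym ez≡0) 0<ey
    ... | no  ez≢0 = subst (λ t → e z < e t) pz≡y (below-parent k z n≤k+lz 1≤z (n≢0⇒n>0 ez≢0))
      where
      n≤k+lz : n ≤ k + level z
      n≤k+lz = subst (n ≤_) (trans (sym (+-suc k (level y))) (cong (k +_) (sym lz≡1+ly))) n≤1+k+ly

  not-below-parent : ∀ w → 1 ≤ w → (∀ {u} → u < w → 1 ≤ u → e u ≡ 0) → e w < e (parent w) → ⊥
  not-below-parent (suc zero)    _ _  ew<ew = <-irrefl refl ew<ew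
  not-below-parent (suc (suc w)) _ ih ew<ep =
    n≮0 (subst (e (suc (suc w)) <_) (ih (⌊n/2⌋<n (suc w)) (s≤s z≤n)) ew<ep)

  vanishes : ∀ w → 1 ≤ w → e w ≡ 0
  vanishes = <-rec (λ w → 1 ≤ w → e w ≡ 0) vanishes-from-above
    where
    vanishes-from-above : ∀ w → (∀ {u} → u < w → 1 ≤ u → e u ≡ 0) → 1 ≤ w → e w ≡ 0
    vanishes-from-above w ih 1≤w with e w ≟ 0
    ... | yes ew≡0 = ew≡0
    ... | no  ew≢0 = ⊥-elim (not-below-parent w 1≤w ih
                       (below-parent n w (m≤m+n n (level w)) 1≤w (n≢0⇒n>0 ew≢0)))

terminal-deficit : ∀ {c₀ vs c} → Run c₀ vs c → Terminal c → ∀ x →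
  (∀ u → timesFired u vs ≤ x u) → ∀ w → 1 ≤ w → c₀ w + inflow x w ≡ 3 * x w + 1 →
  3 * (x w ∸ timesFired w vs) ≤ 1 + inflow (λ u → x u ∸ timesFired u vs) w
terminal-deficit {c₀} {vs} {c} run terminal x fired≤x w 1≤w balanced =
  +-cancelʳ-≤ 1 (3 * e w) (1 + inflow e w) (begin
    3 * e w + 1         ≡⟨ sym deficit-balance ⟩
    c w + inflow e w    ≤⟨ +-monoˡ-≤ (inflow e w) (≤-pred (terminal w)) ⟩
    2 + inflow e w      ≡⟨ cong suc (+-comm 1 (inflow e w)) ⟩
    1 + inflow e w + 1  ∎)
  where
  open ≤-Reasoning
  f e : ℕ → ℕ
  f = firings vs
  e u = x u ∸ f u
  x≡f+e : ∀ u → x u ≡ f u + e u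
  x≡f+e u = sym (m+[n∸m]≡n (fired≤x u))
  deficit-balance : c w + inflow e w ≡ 3 * e w + 1
  deficit-balance = +-cancelʳ-≡ (3 * f w) (c w + inflow e w) (3 * e w + 1) (begin-equality
    c w + inflow e w + 3 * f w        ≡⟨ rearrange₁ (c w) (inflow e w) (3 * f w) ⟩
    c w + 3 * f w + inflow e w        ≡⟨ cong (_+ inflow e w) (run-balance run w 1≤w) ⟩
    c₀ w + inflow f w + inflow e w    ≡⟨ +-assoc (c₀ w) (inflow f w) (inflow e w) ⟩
    c₀ w + (inflow f w + inflow e w)  ≡⟨ cong (c₀ w +_) (sym (inflow-split f e x≡f+e w)) ⟩
    c₀ w + inflow x w                 ≡⟨ balanced ⟩
    3 * x w + 1                       ≡⟨ cong (λ t → 3 * t + 1) (x≡f+e w) ⟩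
    3 * (f w + e w) + 1               ≡⟨ rearrange₂ (f w) (e w) ⟩
    3 * e w + 1 + 3 * f w             ∎)
    where
    rearrange₁ : ∀ a b d → a + b + d ≡ a + d + b
    rearrange₁ = solve-∀
    rearrange₂ : ∀ a b → 3 * (a + b) + 1 ≡ 3 * b + 1 + 3 * a
    rearrange₂ = solve-∀

suc≤2^ : ∀ k → k + 1 ≤ 2 ^ k
suc≤2^ zero    = ≤-refl
suc≤2^ (suc k) = subst (suc k + 1 ≤_) (cong (2 ^ k +_) (sym (+-identityʳ (2 ^ k))))
                   (+-mono-≤ (m^n>0 2 k) (suc≤2^ k))

2^≡eulerian1+suc : ∀ k → 2 ^ k ≡ eulerian1 k + (k + 1)
2^≡eulerian1+suc k = sym (m∸n+n≡m (suc≤2^ k))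

eulerian1-suc : ∀ k → eulerian1 (suc k) ≡ 2 * eulerian1 k + k
eulerian1-suc k = begin
  2 * 2 ^ k ∸ (suc k + 1)                          ≡⟨ cong (λ t → 2 * t ∸ (suc k + 1)) (2^≡eulerian1+suc k) ⟩
  2 * (eulerian1 k + (k + 1)) ∸ (suc k + 1)        ≡⟨ cong (_∸ (suc k + 1)) (rearrange (eulerian1 k) k) ⟩
  2 * eulerian1 k + k + (suc k + 1) ∸ (suc k + 1)  ≡⟨ m+n∸n≡m (2 * eulerian1 k + k) (suc k + 1) ⟩
  2 * eulerian1 k + k                              ∎
  where
  open ≡-Reasoning
  rearrange : ∀ a k → 2 * (a + (k + 1)) ≡ 2 * a + k + (suc k + 1)
  rearrange = solve-∀

2^suc∸1 : ∀ k → 2 ^ suc k ∸ 1 ≡ 2 * eulerian1 k + 2 * k + 1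
2^suc∸1 k = begin
  2 * 2 ^ k ∸ 1                        ≡⟨ cong (λ t → 2 * t ∸ 1) (2^≡eulerian1+suc k) ⟩
  2 * (eulerian1 k + (k + 1)) ∸ 1      ≡⟨ cong (_∸ 1) (rearrange (eulerian1 k) k) ⟩
  2 * eulerian1 k + 2 * k + 1 + 1 ∸ 1  ≡⟨ m+n∸n≡m (2 * eulerian1 k + 2 * k + 1) 1 ⟩
  2 * eulerian1 k + 2 * k + 1          ∎
  where
  open ≡-Reasoning
  rearrange : ∀ a k → 2 * (a + (k + 1)) ≡ 2 * a + 2 * k + 1 + 1
  rearrange = solve-∀

eulerian1-balance : ∀ j →
  eulerian1 (suc (suc j)) + eulerian1 j + eulerian1 j ≡ 3 * eulerian1 (suc j) + 1
eulerian1-balance j rewrite eulerian1-suc (suc j) | eulerian1-suc j = rearrange (eulerian1 j) j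
  where
  rearrange : ∀ a j → 2 * (2 * a + j) + suc j + a + a ≡ 3 * (2 * a + j) + 1
  rearrange = solve-∀

eulerian1-root-balance : ∀ k →
  2 ^ suc k ∸ 1 + (eulerian1 (suc k) + eulerian1 k + eulerian1 k) ≡ 3 * eulerian1 (suc k) + 1
eulerian1-root-balance k rewrite 2^suc∸1 k | eulerian1-suc k = rearrange (eulerian1 k) k
  where
  rearrange : ∀ a k → 2 * a + 2 * k + 1 + (2 * a + k + a + a) ≡ 3 * (2 * a + k) + 1
  rearrange = solve-∀

eulerian1-level-balance : ∀ {ℓ n} → suc ℓ ≤ n →
  eulerian1 (suc n ∸ ℓ) + eulerian1 (suc n ∸ suc (suc ℓ)) + eulerian1 (suc n ∸ suc (suc ℓ))
    ≡ 3 * eulerian1 (suc n ∸ suc ℓ) + 1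
eulerian1-level-balance {zero}  {suc j} _         = eulerian1-balance j
eulerian1-level-balance {suc ℓ} {suc n} (s≤s 1+ℓ≤n) = eulerian1-level-balance 1+ℓ≤n

eulerian1-≤1 : ∀ m → m ≤ 1 → eulerian1 m ≡ 0
eulerian1-≤1 zero       _ = refl
eulerian1-≤1 (suc zero) _ = refl
eulerian1-≤1 (suc (suc m)) (s≤s ())

-- The odometer

odometer : ℕ → ℕ → ℕ
odometer n w = eulerian1 (suc n ∸ level w)

odometer-deep : ∀ n w → n ≤ level w → odometer n w ≡ 0
odometer-deep n w n≤lw =
  eulerian1-≤1 _ (≤-trans (∸-monoʳ-≤ (suc n) n≤lw) (≤-reflexive (m+n∸n≡m 1 n)))

odometer-balance : ∀ n → 1 ≤ n → ∀ w → 1 ≤ w → level w ≤ n →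
  initial n w + inflow (odometer n) w ≡ 3 * odometer n w + 1
odometer-balance (suc k) _ (suc zero) _ _ = eulerian1-root-balance k
odometer-balance n _ w@(suc (suc _)) 1≤w lw≤n = begin
  odometer n (parent w) + odometer n (2 * w) + odometer n (2 * w + 1)
    ≡⟨ cong₂ (λ a b → eulerian1 (suc n ∸ ℓ) + eulerian1 (suc n ∸ a) + eulerian1 (suc n ∸ b))
             (trans (level-2* w 1≤w) (cong suc lw≡1+ℓ)) (trans (level-2*+1 w 1≤w) (cong suc lw≡1+ℓ)) ⟩
  eulerian1 (suc n ∸ ℓ) + eulerian1 (suc n ∸ suc (suc ℓ)) + eulerian1 (suc n ∸ suc (suc ℓ))
    ≡⟨ eulerian1-level-balance (subst (_≤ n) lw≡1+ℓ lw≤n) ⟩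
  3 * eulerian1 (suc n ∸ suc ℓ) + 1
    ≡⟨ cong (λ a → 3 * eulerian1 (suc n ∸ a) + 1) (sym lw≡1+ℓ) ⟩
  3 * odometer n w + 1 ∎
  where
  open ≡-Reasoning
  ℓ : ℕ
  ℓ = level (parent w)
  lw≡1+ℓ : level w ≡ suc ℓ
  lw≡1+ℓ = level-parent w (s≤s (s≤s z≤n))

odometer-beyond : ∀ n → 1 ≤ n → ∀ w → n < level w →
  initial n w + inflow (odometer n) w ≡ 0
odometer-beyond (suc _) _ zero          (s≤s ())
odometer-beyond (suc _) _ (suc zero)    (s≤s ())
odometer-beyond n       _ w@(suc (suc _)) n<lw =
  cong₂ _+_ (cong₂ _+_ (odometer-deep n (parent w) n≤lp)
                       (odometer-deep n (2 * w) (n≤level-child (2 * w) (level-2* w 1≤w))))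
            (odometer-deep n (2 * w + 1) (n≤level-child (2 * w + 1) (level-2*+1 w 1≤w)))
  where
  1≤w : 1 ≤ w
  1≤w = s≤s z≤n
  n≤lw : n ≤ level w
  n≤lw = <⇒≤ n<lw
  n≤lp : n ≤ level (parent w)
  n≤lp = ≤-pred (subst (n <_) (level-parent w (s≤s (s≤s z≤n))) n<lw)
  n≤level-child : ∀ z → level z ≡ suc (level w) → n ≤ level z
  n≤level-child z lz≡1+lw = ≤-trans n≤lw (≤-trans (n≤1+n _) (≤-reflexive (sym lz≡1+lw)))

odometer-stabilizes : ∀ n → 1 ≤ n → Stabilizes (initial n) (odometer n)
odometer-stabilizes n 1≤n w 1≤w with level w ≤? n
... | yes lw≤n = ≤-trans (≤-reflexive (odometer-balance n 1≤n w 1≤w lw≤n)) (+-monoʳ-≤ _ (n≤1+n 1))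
... | no  lw≰n = subst (_≤ 3 * odometer n w + 2) (sym (odometer-beyond n 1≤n w (≰⇒> lw≰n))) z≤n

fired≡odometer : ∀ n → 1 ≤ n → ∀ {vs c} → Run (initial n) vs c → Terminal c →
  ∀ v → 1 ≤ v → timesFired v vs ≡ odometer n v
fired≡odometer n 1≤n {vs} run terminal v 1≤v =
  ≤-antisym (fired≤odometer v) (m∸n≡0⇒m≤n (Deficit.vanishes n deficit deficit-deep deficit-subharmonic v 1≤v))
  where
  fired≤odometer : ∀ u → timesFired u vs ≤ odometer n u
  fired≤odometer = least-action run (odometer n) (odometer-stabilizes n 1≤n)
  deficit : ℕ → ℕ
  deficit u = odometer n u ∸ timesFired u vs
  deficit-deep : ∀ w → n ≤ level w → deficit w ≡ 0
  deficit-deep w n≤lw = trans (cong (_∸ timesFired w vs) (odometer-deep n w n≤lw)) (0∸n≡0 (timesFired w vs))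
  deficit-subharmonic : ∀ w → 1 ≤ w → level w < n → 3 * deficit w ≤ 1 + inflow deficit w
  deficit-subharmonic w 1≤w lw<n = terminal-deficit run terminal (odometer n) fired≤odometer w 1≤w
                                     (odometer-balance n 1≤n w 1≤w (<⇒≤ lw<n))

proposition3p6 : (n : ℕ) → 1 ≤ n → (vs : List ℕ) → (c : Config) →
    Run (initial n) vs c → Terminal c →
    (i : ℕ) → i < n → (v : ℕ) → 1 ≤ v → level v ≡ n ∸ i →
    timesFired v vs ≡ eulerian1 (i + 1)
proposition3p6 n 1≤n vs c run terminal i i<n v 1≤v lv≡n∸i = begin
  timesFired v vs                ≡⟨ fired≡odometer n 1≤n run terminal v 1≤v ⟩
  eulerian1 (suc n ∸ level v)    ≡⟨ cong (λ l → eulerian1 (suc n ∸ l)) lv≡n∸i ⟩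
  eulerian1 (suc n ∸ (n ∸ i))    ≡⟨ cong eulerian1 (+-∸-assoc 1 (m∸n≤m n i)) ⟩
  eulerian1 (suc (n ∸ (n ∸ i)))  ≡⟨ cong (λ m → eulerian1 (suc m)) (m∸[m∸n]≡n (<⇒≤ i<n)) ⟩
  eulerian1 (suc i)              ≡⟨ cong eulerian1 (+-comm 1 i) ⟩
  eulerian1 (i + 1)              ∎
  where open ≡-Reasoning
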